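{- Every (finite, simple) graph of twin-width at most $1$ is a permutation graph.
   Context: A trigraph $H$ consists of a vertex set $V(H)$ and two disjoint sets $B(H)$ (black edges) and $R(H)$ (red edges) of unordered pairs of vertices; a graph is a trigraph with no red edges. The red degree of a vertex is its number of incident red edges. Contracting two distinct vertices $u,v$ of $H$ produces the trigraph obtained from $H-\{u,v\}$ by adding a new vertex $x$ such that for every other vertex $y$: $xy$ is a black edge if $y$ is a black neighbour of both $u$ and $v$; $xy$ is not an edge if $y$ is adjacent (by any edge) to neither $u$ nor $v$; and $xy$ is a red edge otherwise. A contraction sequence of an $n$-vertex graph $G$ is a sequence of trigraphs $G_n=G,G_{n-1},\dots,G_1$ where $G_1$ has one vertex and each $G_{i-1}$ is obtained from $G_i$ by contracting a pair of vertices. It is a $d$-sequence if every $G_i$ has maximum red degree at most $d$. The twin-width of $G$ is the least $d$ such that $G$ admits a $d$-sequence. A graph $G$ on $n$ vertices is a permutation graph if there are bijections $\sigma,\tau:V(G)\to[n]$ such that distinct $u,v$ are adjacent iff $\sigma$ and $\tau$ order $u,v$ differently (i.e. $(\sigma(u)-\sigma(v))(\tau(u)-\tau(v))<0$). -}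

module Defs where

open import Data.Nat using (ℕ; zero; suc; _+_; _≤_)
open import Data.Fin using (Fin; _≟_; punchIn; _<_)
open import Data.Bool using (Bool; true; false)
open import Data.List using (List; allFin; map)
open import Data.Nat.ListAction using (sum)
open import Data.Product using (Σ; _×_; _,_)
open import Data.Sum using (_⊎_)
open import Data.Unit using (⊤)
open import Relation.Nullary using (¬_; yes; no)
open import Relation.Binary.PropositionalEquality using (_≡_; _≢_)
open import Function.Bundles using (_⤖_; Bijection)
open import Function.Bundles using (_⇔_)

data EdgeType : Set where
  none black red : EdgeType

-- A trigraph on vertex set Fin n, given by the type of the pair {i,j}.
-- (Values on the diagonal are irrelevant and ignored everywhere.)
Trigraph : ℕ → Set
Trigraph n = Fin n → Fin n → EdgeType

record Graph (n : ℕ) : Set where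
  field
    adj   : Fin n → Fin n → Bool
    sym   : ∀ u v → adj u v ≡ adj v u
    irrefl : ∀ u → adj u u ≡ false

toTrigraph : ∀ {n} → Graph n → Trigraph n
toTrigraph G u v with Graph.adj G u v
... | true  = black
... | false = none

-- Type of the edge xy, x the contraction of u and v, given types of uy and vy.
merge : EdgeType → EdgeType → EdgeType
merge black black = black
merge none  none  = none
merge _     _     = red

-- Contract u and v in H (on Fin (suc m)); the result lives on Fin m:
-- vertex i of the result is vertex (punchIn v i) of H, where the vertex
-- punchIn v i = u plays the role of the new vertex x.
contract : ∀ {m} → Trigraph (suc m) → Fin (suc m) → Fin (suc m) → Trigraph m
contract H u v i j with punchIn v i ≟ u | punchIn v j ≟ u
... | yes _ | yes _ = none
... | yes _ | no _  = merge (H u (punchIn v j)) (H v (punchIn v j))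
... | no _  | yes _ = merge (H (punchIn v i) u) (H (punchIn v i) v)
... | no _  | no _  = H (punchIn v i) (punchIn v j)

isRed : EdgeType → ℕ
isRed red = 1
isRed _   = 0

redDeg : ∀ {n} → Trigraph n → Fin n → ℕ
redDeg {n} H i = sum (map f (allFin n))
  where
  f : Fin n → ℕ
  f j with i ≟ j
  ... | yes _ = 0
  ... | no _  = isRed (H i j)

MaxRedDegAtMost : ℕ → ∀ {n} → Trigraph n → Set
MaxRedDegAtMost d H = ∀ i → redDeg H i ≤ d

data DSeq (d : ℕ) : ∀ {m} → Trigraph (suc m) → Set where
  done : (H : Trigraph 1) → MaxRedDegAtMost d H → DSeq d {0} H
  step : ∀ {m} (H : Trigraph (suc (suc m))) → MaxRedDegAtMost d H →
         (u v : Fin (suc (suc m))) → u ≢ v →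
         DSeq d (contract H u v) → DSeq d H

-- twin-width at most d (the null graph is taken to have twin-width 0)
TwinWidthAtMost : ℕ → ∀ {n} → Graph n → Set
TwinWidthAtMost d {zero}  G = ⊤
TwinWidthAtMost d {suc m} G = DSeq d (toTrigraph G)

OrderedDifferently : ∀ {n} → (σ τ : Fin n ⤖ Fin n) → Fin n → Fin n → Set
OrderedDifferently σ τ u v =
  (Bijection.to σ u < Bijection.to σ v × Bijection.to τ v < Bijection.to τ u) ⊎
  (Bijection.to σ v < Bijection.to σ u × Bijection.to τ u < Bijection.to τ v)

IsPermutationGraph : ∀ {n} → Graph n → Set
IsPermutationGraph {n} G =
  Σ (Fin n ⤖ Fin n) λ σ → Σ (Fin n ⤖ Fin n) λ τ →
    ∀ u v → u ≢ v → (Graph.adj G u v ≡ true ⇔ OrderedDifferently σ τ u v)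

module Submission where

-- Run the contraction sequence backwards. Say that a symmetric trigraph H is
-- realizable if every completion of H (a graph agreeing with H on black edges and
-- non-edges, red edges being resolved arbitrarily) is realized as a permutation
-- graph by two injective position maps p, q into ℕ in such a way that the ends of
-- every red edge of H are consecutive in p or in q. One vertex is realizable. If
-- H′ = contract H u v has red degree ≤ 1, realize the restriction of a completion
-- of H to H′ and insert v next to x = {u,v} in q and next to x or next to the unique
-- red neighbour y of x in p (the red edge xy being consecutive in p, say). Outside
-- x and y, v sees every vertex exactly as u does, because xw is not red; the order
-- relations of v with x and y are fixed by the choice of sides. Red degree ≤ 1
-- leaves only the red edges vx, vy and uy of H to keep consecutive. A graph is its
-- own only completion.

open import Defs
open import Data.Nat as ℕ using (ℕ; zero; suc; _+_; _≤_; _<_; z≤n; _<ᵇ_)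
import Data.Nat.Properties as ℕ
open import Data.Fin as Fin using (Fin; punchIn; punchOut; fromℕ<)
import Data.Fin.Properties as Fin
open import Data.Bool as Bool using (Bool; true; false; not; _xor_; if_then_else_)
open import Data.Bool.Properties using (xor-comm; xor-assoc; xor-same; xor-identityʳ; not-involutive; ¬-not)
open import Data.List using (allFin; map; tabulate)
open import Data.List.Properties using (map-tabulate)
open import Data.Nat.ListAction using (sum)
open import Data.Product using (Σ; _×_; _,_; ∃)
open import Data.Sum using (_⊎_; inj₁; inj₂)
import Data.Sum as Sum
open import Data.Unit using (⊤; tt)
open import Relation.Nullary using (yes; no; Dec; contradiction)
open import Relation.Nullary.Decidable using (¬?; _×-dec_)
open import Relation.Binary.PropositionalEquality
open import Function using (_∘_; id; _∋_)
open import Function.Bundles using (_⤖_; mk⤖; mk⇔)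
open import Function.Construct.Identity using (⤖-id)

term≤sum-tabulate : ∀ {n} (f : Fin n → ℕ) j → f j ≤ sum (tabulate f)
term≤sum-tabulate f Fin.zero    = ℕ.m≤m+n _ _
term≤sum-tabulate f (Fin.suc j) = ℕ.≤-trans (term≤sum-tabulate (f ∘ Fin.suc) j) (ℕ.m≤n+m _ _)

twoTerms≤sum-tabulate : ∀ {n} (f : Fin n → ℕ) {j k} → j ≢ k → f j + f k ≤ sum (tabulate f)
twoTerms≤sum-tabulate f {Fin.zero}  {Fin.zero}  j≢k = contradiction refl j≢k
twoTerms≤sum-tabulate f {Fin.zero}  {Fin.suc k} _   =
  ℕ.+-monoʳ-≤ (f Fin.zero) (term≤sum-tabulate (f ∘ Fin.suc) k)
twoTerms≤sum-tabulate f {Fin.suc j} {Fin.zero}  _   =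
  subst (_≤ sum (tabulate f)) (ℕ.+-comm (f Fin.zero) (f (Fin.suc j)))
        (ℕ.+-monoʳ-≤ (f Fin.zero) (term≤sum-tabulate (f ∘ Fin.suc) j))
twoTerms≤sum-tabulate f {Fin.suc j} {Fin.suc k} j≢k =
  ℕ.≤-trans (twoTerms≤sum-tabulate (f ∘ Fin.suc) (j≢k ∘ cong Fin.suc)) (ℕ.m≤n+m _ _)

sum-tabulate-mono-≤ : ∀ {n} {f g : Fin n → ℕ} → (∀ i → f i ≤ g i) → sum (tabulate f) ≤ sum (tabulate g)
sum-tabulate-mono-≤ {zero}  f≤g = z≤n
sum-tabulate-mono-≤ {suc n} f≤g = ℕ.+-mono-≤ (f≤g Fin.zero) (sum-tabulate-mono-≤ (f≤g ∘ Fin.suc))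

sum-tabulate-mono-< : ∀ {n} {f g : Fin n → ℕ} → (∀ i → f i ≤ g i) → ∀ j → f j < g j →
                      sum (tabulate f) < sum (tabulate g)
sum-tabulate-mono-< f≤g Fin.zero    fj<gj = ℕ.+-mono-<-≤ fj<gj (sum-tabulate-mono-≤ (f≤g ∘ Fin.suc))
sum-tabulate-mono-< f≤g (Fin.suc j) fj<gj =
  ℕ.+-mono-≤-< (f≤g Fin.zero) (sum-tabulate-mono-< (f≤g ∘ Fin.suc) j fj<gj)

sum-tabulate-1 : ∀ n → sum (tabulate {n = n} (λ _ → 1)) ≡ n
sum-tabulate-1 zero    = refl
sum-tabulate-1 (suc n) = cong suc (sum-tabulate-1 n)

twoTerms≤sum-allFin : ∀ {n} (f : Fin n → ℕ) {j k} → j ≢ k → f j + f k ≤ sum (map f (allFin n))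
twoTerms≤sum-allFin f j≢k =
  subst (_ ≤_) (cong sum (sym (map-tabulate id f))) (twoTerms≤sum-tabulate f j≢k)

twoRed≤redDeg : ∀ {n} (H : Trigraph n) {i j k} → i ≢ j → i ≢ k → j ≢ k →
                isRed (H i j) + isRed (H i k) ≤ redDeg H i
twoRed≤redDeg H {i} {j} {k} i≢j i≢k j≢k
  with i Fin.≟ j | i Fin.≟ k | (_ ≤ redDeg H i) ∋ twoTerms≤sum-allFin _ j≢k
... | yes i≡j | _       | _     = contradiction i≡j i≢j
... | no _    | yes i≡k | _     = contradiction i≡k i≢k
... | no _    | no _    | bound = bound

atMostOneRedNeighbour : ∀ {n} {H : Trigraph n} → MaxRedDegAtMost 1 H →
                        ∀ {i j k} → i ≢ j → i ≢ k → H i j ≡ red → H i k ≡ red → j ≡ k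
atMostOneRedNeighbour {H = H} deg {i} {j} {k} i≢j i≢k ij-red ik-red with j Fin.≟ k
... | yes j≡k = j≡k
... | no j≢k  = contradiction
  (subst₂ (λ e f → isRed e + isRed f ≤ 1) ij-red ik-red (ℕ.≤-trans (twoRed≤redDeg H i≢j i≢k j≢k) (deg i)))
  ℕ.1+n≰n

red? : (e : EdgeType) → Dec (e ≡ red)
red? none  = no λ ()
red? black = no λ ()
red? red   = yes refl

Compatible : EdgeType → Bool → Set
Compatible none  c = c ≡ false
Compatible black c = c ≡ true
Compatible red   _ = ⊤

compatible-merge : ∀ a b {c} → Compatible a c → Compatible (merge a b) c
compatible-merge none  none  c = c
compatible-merge none  black _ = tt
compatible-merge none  red   _ = tt
compatible-merge black none  _ = tt
compatible-merge black black c = c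
compatible-merge black red   _ = tt
compatible-merge red   _     _ = tt

merge-redʳ : ∀ a → merge a red ≡ red
merge-redʳ none  = refl
merge-redʳ black = refl
merge-redʳ red   = refl

compatible-merge-agree : ∀ a b {c d} → merge a b ≢ red → Compatible a c → Compatible b d → c ≡ d
compatible-merge-agree none  none  ≢red c d = trans c (sym d)
compatible-merge-agree black black ≢red c d = trans c (sym d)
compatible-merge-agree none  black ≢red _ _ = contradiction refl ≢red
compatible-merge-agree none  red   ≢red _ _ = contradiction refl ≢red
compatible-merge-agree black none  ≢red _ _ = contradiction refl ≢red
compatible-merge-agree black red   ≢red _ _ = contradiction refl ≢red
compatible-merge-agree red   _     ≢red _ _ = contradiction refl ≢red

IsSymmetric : ∀ {n} → Trigraph n → Set
IsSymmetric H = ∀ a b → H a b ≡ H b a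

record IsCompletion {n} (H : Trigraph n) (C : Fin n → Fin n → Bool) : Set where
  field
    compatible : ∀ a b → a ≢ b → Compatible (H a b) (C a b)
    symmetric  : ∀ a b → C a b ≡ C b a

module Contraction {m} (H : Trigraph (suc m)) (u v : Fin (suc m)) where

  contract-outside : ∀ i j → punchIn v i ≢ u → punchIn v j ≢ u →
                     contract H u v i j ≡ H (punchIn v i) (punchIn v j)
  contract-outside i j i≢u j≢u with punchIn v i Fin.≟ u | punchIn v j Fin.≟ u
  ... | yes i≡u | _       = contradiction i≡u i≢u
  ... | no _    | yes j≡u = contradiction j≡u j≢u
  ... | no _    | no _    = refl

  contract-from : ∀ i j → punchIn v i ≡ u → punchIn v j ≢ u →
                  contract H u v i j ≡ merge (H u (punchIn v j)) (H v (punchIn v j))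
  contract-from i j i≡u j≢u with punchIn v i Fin.≟ u | punchIn v j Fin.≟ u
  ... | no i≢u | _       = contradiction i≡u i≢u
  ... | yes _  | yes j≡u = contradiction j≡u j≢u
  ... | yes _  | no _    = refl

  contract-to : ∀ i j → punchIn v i ≢ u → punchIn v j ≡ u →
                contract H u v i j ≡ merge (H (punchIn v i) u) (H (punchIn v i) v)
  contract-to i j i≢u j≡u with punchIn v i Fin.≟ u | punchIn v j Fin.≟ u
  ... | yes i≡u | _      = contradiction i≡u i≢u
  ... | no _    | no j≢u = contradiction j≡u j≢u
  ... | no _    | yes _  = refl

  contract-symmetric : IsSymmetric H → IsSymmetric (contract H u v)
  contract-symmetric sym-H i j with punchIn v i Fin.≟ u | punchIn v j Fin.≟ u
  ... | yes _ | yes _ = refl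
  ... | yes _ | no _  = cong₂ merge (sym-H _ _) (sym-H _ _)
  ... | no _  | yes _ = cong₂ merge (sym-H _ _) (sym-H _ _)
  ... | no _  | no _  = sym-H _ _

<ᵇ-irrefl : ∀ a → (a <ᵇ a) ≡ false
<ᵇ-irrefl zero    = refl
<ᵇ-irrefl (suc a) = <ᵇ-irrefl a

<ᵇ-swap : ∀ {a b} → a ≢ b → (b <ᵇ a) ≡ not (a <ᵇ b)
<ᵇ-swap {zero}  {zero}  a≢b = contradiction refl a≢b
<ᵇ-swap {zero}  {suc b} _   = refl
<ᵇ-swap {suc a} {zero}  _   = refl
<ᵇ-swap {suc a} {suc b} a≢b = <ᵇ-swap (a≢b ∘ cong suc)

<ᵇ-trans : ∀ a b c → (a <ᵇ b) ≡ true → (b <ᵇ c) ≡ true → (a <ᵇ c) ≡ true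
<ᵇ-trans a       b       zero    _  ()
<ᵇ-trans a       zero    (suc c) () _
<ᵇ-trans zero    (suc b) (suc c) _  _  = refl
<ᵇ-trans (suc a) (suc b) (suc c) ab bc = <ᵇ-trans a b c ab bc

-- Inserting one vertex into an order given by positions: every old position x
-- becomes 2x+1, and the new vertex takes 2x (just below x) or 2x+2 (just above x),
-- so that it becomes a neighbour of x.
double : ℕ → ℕ
double zero    = zero
double (suc n) = suc (suc (double n))

shift : ℕ → ℕ
shift x = suc (double x)

beside : Bool → ℕ → ℕ
beside true  x = double x
beside false x = double (suc x)

double-<ᵇ : ∀ a b → (double a <ᵇ double b) ≡ (a <ᵇ b)
double-<ᵇ zero    zero    = refl
double-<ᵇ zero    (suc b) = refl
double-<ᵇ (suc a) zero    = refl
double-<ᵇ (suc a) (suc b) = double-<ᵇ a b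

shift-<ᵇ : ∀ a b → (shift a <ᵇ shift b) ≡ (a <ᵇ b)
shift-<ᵇ = double-<ᵇ

double-injective : ∀ {a b} → double a ≡ double b → a ≡ b
double-injective {zero}  {zero}  _ = refl
double-injective {suc a} {suc b} e = cong suc (double-injective (ℕ.suc-injective (ℕ.suc-injective e)))

shift-injective : ∀ {a b} → shift a ≡ shift b → a ≡ b
shift-injective = double-injective ∘ ℕ.suc-injective

double≢shift : ∀ a b → double a ≢ shift b
double≢shift (suc a) (suc b) e = double≢shift a b (ℕ.suc-injective (ℕ.suc-injective e))

beside≢shift : ∀ s x y → beside s x ≢ shift y
beside≢shift true  x = double≢shift x
beside≢shift false x = double≢shift (suc x)

beside-<ᵇ-self : ∀ s x → (beside s x <ᵇ shift x) ≡ s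
beside-<ᵇ-self true  zero    = refl
beside-<ᵇ-self true  (suc x) = beside-<ᵇ-self true x
beside-<ᵇ-self false zero    = refl
beside-<ᵇ-self false (suc x) = beside-<ᵇ-self false x

double-<ᵇ-shift : ∀ {a b} → a ≢ b → (double a <ᵇ shift b) ≡ (a <ᵇ b)
double-<ᵇ-shift {zero}  {zero}  a≢b = contradiction refl a≢b
double-<ᵇ-shift {zero}  {suc b} _   = refl
double-<ᵇ-shift {suc a} {zero}  _   = refl
double-<ᵇ-shift {suc a} {suc b} a≢b = double-<ᵇ-shift (a≢b ∘ cong suc)

double-suc-<ᵇ-shift : ∀ {a b} → a ≢ b → (double (suc a) <ᵇ shift b) ≡ (a <ᵇ b)
double-suc-<ᵇ-shift {zero}  {zero}        a≢b = contradiction refl a≢b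
double-suc-<ᵇ-shift {zero}  {suc zero}    _   = refl
double-suc-<ᵇ-shift {zero}  {suc (suc b)} _   = refl
double-suc-<ᵇ-shift {suc a} {zero}        _   = refl
double-suc-<ᵇ-shift {suc a} {suc b}       a≢b = double-suc-<ᵇ-shift (a≢b ∘ cong suc)

beside-<ᵇ-shift : ∀ s {x y} → x ≢ y → (beside s x <ᵇ shift y) ≡ (x <ᵇ y)
beside-<ᵇ-shift true  = double-<ᵇ-shift
beside-<ᵇ-shift false = double-suc-<ᵇ-shift

shift-<ᵇ-beside : ∀ s {x y} → x ≢ y → (shift y <ᵇ beside s x) ≡ (y <ᵇ x)
shift-<ᵇ-beside s {x} {y} x≢y = begin
  shift y <ᵇ beside s x        ≡⟨ <ᵇ-swap (beside≢shift s x y) ⟩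
  not (beside s x <ᵇ shift y)  ≡⟨ cong not (beside-<ᵇ-shift s x≢y) ⟩
  not (x <ᵇ y)                 ≡⟨ <ᵇ-swap x≢y ⟨
  y <ᵇ x                       ∎
  where open ≡-Reasoning

xor-cancelˡ : ∀ a b → a xor (a xor b) ≡ b
xor-cancelˡ a b = trans (sym (xor-assoc a a b)) (cong (_xor b) (xor-same a))

xor-cancelʳ : ∀ a b → (a xor b) xor b ≡ a
xor-cancelʳ a b = trans (xor-assoc a b b) (trans (cong (a xor_) (xor-same b)) (xor-identityʳ a))

not-xor-not : ∀ a b → not a xor not b ≡ a xor b
not-xor-not true  b = refl
not-xor-not false b = not-involutive b

Injective : ∀ {n} → (Fin n → ℕ) → Set
Injective f = ∀ a b → a ≢ b → f a ≢ f b

record Realizer {n} (C : Fin n → Fin n → Bool) (p q : Fin n → ℕ) : Set where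
  field
    p-injective : Injective p
    q-injective : Injective q
    adjacency   : ∀ a b → a ≢ b → C a b ≡ (p a <ᵇ p b) xor (q a <ᵇ q b)

realizer-swap : ∀ {n C} {p q : Fin n → ℕ} → Realizer C p q → Realizer C q p
realizer-swap {p = p} {q} r = record
  { p-injective = q-injective
  ; q-injective = p-injective
  ; adjacency   = λ a b a≢b → trans (adjacency a b a≢b) (xor-comm (p a <ᵇ p b) (q a <ᵇ q b))
  }
  where open Realizer r

Consecutive : ∀ {n} → (Fin n → ℕ) → Fin n → Fin n → Set
Consecutive p a b = ∀ w → w ≢ a → w ≢ b → (p a <ᵇ p w) ≡ (p b <ᵇ p w)

consecutive-sym : ∀ {n} {p : Fin n → ℕ} {a b} → Consecutive p a b → Consecutive p b a
consecutive-sym c w w≢b w≢a = sym (c w w≢a w≢b)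

consecutive⊎-sym : ∀ {n} {p q : Fin n → ℕ} {a b} →
                   Consecutive p a b ⊎ Consecutive q a b → Consecutive p b a ⊎ Consecutive q b a
consecutive⊎-sym {p = p} {q} = Sum.map (consecutive-sym {p = p}) (consecutive-sym {p = q})

RedConsecutive : ∀ {n} → Trigraph n → (Fin n → ℕ) → (Fin n → ℕ) → Set
RedConsecutive H p q = ∀ a b → a ≢ b → H a b ≡ red → Consecutive p a b ⊎ Consecutive q a b

redConsecutive-swap : ∀ {n} {H : Trigraph n} {p q} → RedConsecutive H p q → RedConsecutive H q p
redConsecutive-swap rc a b a≢b ab-red = Sum.swap (rc a b a≢b ab-red)

Realization : ∀ {n} → Trigraph n → (Fin n → Fin n → Bool) → Set
Realization {n} H C = Σ (Fin n → ℕ) λ p → Σ (Fin n → ℕ) λ q → Realizer C p q × RedConsecutive H p q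

Realizable : ∀ {n} → Trigraph n → Set
Realizable H = ∀ C → IsCompletion H C → Realization H C

module Uncontraction {m} (H : Trigraph (suc (suc m))) (H-sym : IsSymmetric H)
                     (u v : Fin (suc (suc m))) (u≢v : u ≢ v) where

  open Contraction H u v

  H′ : Trigraph (suc m)
  H′ = contract H u v

  ι : Fin (suc m) → Fin (suc (suc m))
  ι = punchIn v

  x : Fin (suc m)
  x = punchOut (u≢v ∘ sym)

  ιx≡u : ι x ≡ u
  ιx≡u = Fin.punchIn-punchOut (u≢v ∘ sym)

  ι-injective : ∀ {i j} → ι i ≡ ι j → i ≡ j
  ι-injective = Fin.punchIn-injective v _ _

  ι≢v : ∀ j → ι j ≢ v
  ι≢v = Fin.punchInᵢ≢i v

  ι≢u : ∀ {j} → j ≢ x → ι j ≢ u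
  ι≢u j≢x ιj≡u = j≢x (ι-injective (trans ιj≡u (sym ιx≡u)))

  H′-outside : ∀ {i j} → i ≢ x → j ≢ x → H′ i j ≡ H (ι i) (ι j)
  H′-outside i≢x j≢x = contract-outside _ _ (ι≢u i≢x) (ι≢u j≢x)

  H′-from-x : ∀ {j} → j ≢ x → H′ x j ≡ merge (H u (ι j)) (H v (ι j))
  H′-from-x j≢x = contract-from x _ ιx≡u (ι≢u j≢x)

  H′-to-x : ∀ {i} → i ≢ x → H′ i x ≡ merge (H (ι i) u) (H (ι i) v)
  H′-to-x i≢x = contract-to _ x (ι≢u i≢x) ιx≡u

  H′-red-from-u : ∀ {j} → j ≢ x → H (ι x) (ι j) ≡ red → H′ x j ≡ red
  H′-red-from-u {j} j≢x red-uj = begin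
    H′ x j                             ≡⟨ H′-from-x j≢x ⟩
    merge (H u (ι j)) (H v (ι j))      ≡⟨ cong (λ w → merge (H w (ι j)) (H v (ι j))) (sym ιx≡u) ⟩
    merge (H (ι x) (ι j)) (H v (ι j))  ≡⟨ cong (λ e → merge e (H v (ι j))) red-uj ⟩
    red                                ∎
    where open ≡-Reasoning

  H′-red-from-v : ∀ {j} → j ≢ x → H v (ι j) ≡ red → H′ x j ≡ red
  H′-red-from-v {j} j≢x red-vj =
    trans (H′-from-x j≢x) (trans (cong (merge (H u (ι j))) red-vj) (merge-redʳ _))

  data Vertex : Fin (suc (suc m)) → Set where
    new : Vertex v
    old : ∀ j → Vertex (ι j)

  vertex : ∀ w → Vertex w
  vertex w with v Fin.≟ w
  ... | yes refl = new
  ... | no v≢w   = subst Vertex (Fin.punchIn-punchOut v≢w) (old (punchOut v≢w))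

  extend : (Fin (suc m) → ℕ) → ℕ → Fin (suc (suc m)) → ℕ
  extend f k w with v Fin.≟ w
  ... | yes _  = k
  ... | no v≢w = shift (f (punchOut v≢w))

  extend-v : ∀ f k → extend f k v ≡ k
  extend-v f k with v Fin.≟ v
  ... | yes _  = refl
  ... | no v≢v = contradiction refl v≢v

  extend-ι : ∀ f k j → extend f k (ι j) ≡ shift (f j)
  extend-ι f k j with v Fin.≟ ι j
  ... | yes v≡ιj = contradiction (sym v≡ιj) (ι≢v j)
  ... | no v≢ιj  = cong (shift ∘ f) (trans (Fin.punchOut-cong v refl) (Fin.punchOut-punchIn v))

  extend-injective : ∀ {f k} → Injective f → (∀ j → k ≢ shift (f j)) → Injective (extend f k)
  extend-injective {f} {k} f-inj k-new a b a≢b with vertex a | vertex b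
  ... | new   | new   = contradiction refl a≢b
  ... | new   | old j = λ e → k-new j (trans (sym (extend-v f k)) (trans e (extend-ι f k j)))
  ... | old i | new   = λ e → k-new i (trans (sym (extend-v f k)) (trans (sym e) (extend-ι f k i)))
  ... | old i | old j = λ e → f-inj i j (a≢b ∘ cong ι)
                          (shift-injective (trans (sym (extend-ι f k i)) (trans e (extend-ι f k j))))

  consecutive-extend : ∀ {f k i j} → Consecutive f i j → (shift (f i) <ᵇ k) ≡ (shift (f j) <ᵇ k) →
                       Consecutive (extend f k) (ι i) (ι j)
  consecutive-extend {f} {k} {i} {j} c k-outside w w≢i w≢j with vertex w
  ... | new rewrite extend-v f k | extend-ι f k i | extend-ι f k j = k-outside
  ... | old w′ rewrite extend-ι f k i | extend-ι f k j | extend-ι f k w′ =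
    trans (shift-<ᵇ (f i) (f w′)) (trans (c w′ (w≢i ∘ cong ι) (w≢j ∘ cong ι)) (sym (shift-<ᵇ (f j) (f w′))))

  consecutive-extend-beside : ∀ {f} s {a i j} → Injective f → Consecutive f i j → a ≢ i → a ≢ j →
                              Consecutive (extend f (beside s (f a))) (ι i) (ι j)
  consecutive-extend-beside {f} s {a} {i} {j} f-inj c a≢i a≢j = consecutive-extend c (begin
    shift (f i) <ᵇ beside s (f a)  ≡⟨ shift-<ᵇ-beside s (f-inj a i a≢i) ⟩
    f i <ᵇ f a                     ≡⟨ c a a≢i a≢j ⟩
    f j <ᵇ f a                     ≡⟨ sym (shift-<ᵇ-beside s (f-inj a j a≢j)) ⟩
    shift (f j) <ᵇ beside s (f a)  ∎)
    where open ≡-Reasoning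

  consecutive-beside : ∀ {f} s {a} → Injective f → Consecutive (extend f (beside s (f a))) v (ι a)
  consecutive-beside {f} s {a} f-inj w w≢v w≢ιa with vertex w
  ... | new = contradiction refl w≢v
  ... | old w′ rewrite extend-v f (beside s (f a)) | extend-ι f (beside s (f a)) a
                     | extend-ι f (beside s (f a)) w′ =
    trans (beside-<ᵇ-shift s (f-inj a w′ (w≢ιa ∘ cong ι ∘ sym))) (sym (shift-<ᵇ (f a) (f w′)))

  redConsecutive-extend : ∀ {p q} →
    (∀ j → H v (ι j) ≡ red → Consecutive p v (ι j) ⊎ Consecutive q v (ι j)) →
    (∀ j → j ≢ x → H (ι x) (ι j) ≡ red → Consecutive p (ι x) (ι j) ⊎ Consecutive q (ι x) (ι j)) →
    (∀ i j → i ≢ x → j ≢ x → i ≢ j → H′ i j ≡ red → Consecutive p (ι i) (ι j) ⊎ Consecutive q (ι i) (ι j)) →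
    RedConsecutive H p q
  redConsecutive-extend {p} {q} at-v at-x elsewhere a b a≢b ab-red with vertex a | vertex b
  ... | new   | new   = contradiction refl a≢b
  ... | new   | old j = at-v j ab-red
  ... | old i | new   = consecutive⊎-sym {p = p} {q} (at-v i (trans (H-sym v (ι i)) ab-red))
  ... | old i | old j with i Fin.≟ x | j Fin.≟ x
  ...   | yes refl | _        = at-x j (a≢b ∘ cong ι ∘ sym) ab-red
  ...   | no i≢x   | yes refl = consecutive⊎-sym {p = p} {q} (at-x i i≢x (trans (H-sym _ _) ab-red))
  ...   | no i≢x   | no j≢x   = elsewhere i j i≢x j≢x (a≢b ∘ cong ι) (trans (H′-outside i≢x j≢x) ab-red)

  module Completed (C : Fin (suc (suc m)) → Fin (suc (suc m)) → Bool) (C-compl : IsCompletion H C) where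
    open IsCompletion C-compl

    C′ : Fin (suc m) → Fin (suc m) → Bool
    C′ i j = C (ι i) (ι j)

    C′-compatible : ∀ i j → i ≢ j → Compatible (H′ i j) (C′ i j)
    C′-compatible i j i≢j with i Fin.≟ x | j Fin.≟ x
    ... | yes refl | yes refl = contradiction refl i≢j
    ... | yes refl | no j≢x   = subst₂ Compatible (sym (H′-from-x j≢x)) (cong (λ w → C w (ι j)) (sym ιx≡u))
                                  (compatible-merge _ _ (compatible u (ι j) (ι≢u j≢x ∘ sym)))
    ... | no i≢x   | yes refl = subst₂ Compatible (sym (H′-to-x i≢x)) (cong (C (ι i)) (sym ιx≡u))
                                  (compatible-merge _ _ (compatible (ι i) u (ι≢u i≢x)))
    ... | no i≢x   | no j≢x   = subst (λ e → Compatible e (C′ i j)) (sym (H′-outside i≢x j≢x))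
                                  (compatible (ι i) (ι j) (i≢j ∘ ι-injective))

    C′-completion : IsCompletion H′ C′
    C′-completion = record { compatible = C′-compatible ; symmetric = λ i j → symmetric (ι i) (ι j) }

    C-v≡C′-x : ∀ {j} → j ≢ x → H′ x j ≢ red → C v (ι j) ≡ C′ x j
    C-v≡C′-x {j} j≢x xj-nonRed = begin
      C v (ι j)    ≡⟨ compatible-merge-agree (H u (ι j)) (H v (ι j)) (xj-nonRed ∘ trans (H′-from-x j≢x))
                        (compatible u (ι j) (ι≢u j≢x ∘ sym)) (compatible v (ι j) (ι≢v j ∘ sym)) ⟨
      C u (ι j)    ≡⟨ cong (λ w → C w (ι j)) ιx≡u ⟨
      C (ι x) (ι j) ∎
      where open ≡-Reasoning

    realizer-extend : ∀ {p′ q′ kp kq} → Realizer C′ p′ q′ →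
      (∀ j → kp ≢ shift (p′ j)) → (∀ j → kq ≢ shift (q′ j)) →
      (∀ j → C v (ι j) ≡ (kp <ᵇ shift (p′ j)) xor (kq <ᵇ shift (q′ j))) →
      Realizer C (extend p′ kp) (extend q′ kq)
    realizer-extend {p′} {q′} {kp} {kq} r kp-new kq-new adj-v = record
      { p-injective = extend-injective p-injective kp-new
      ; q-injective = extend-injective q-injective kq-new
      ; adjacency   = adj
      }
      where
      open Realizer r
      adj : ∀ a b → a ≢ b → C a b ≡ (extend p′ kp a <ᵇ extend p′ kp b) xor (extend q′ kq a <ᵇ extend q′ kq b)
      adj a b a≢b with vertex a | vertex b
      ... | new   | new   = contradiction refl a≢b
      ... | new   | old j
        rewrite extend-v p′ kp | extend-v q′ kq | extend-ι p′ kp j | extend-ι q′ kq j = adj-v j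
      ... | old i | new
        rewrite extend-v p′ kp | extend-v q′ kq | extend-ι p′ kp i | extend-ι q′ kq i = begin
        C (ι i) v
          ≡⟨ symmetric (ι i) v ⟩
        C v (ι i)
          ≡⟨ adj-v i ⟩
        (kp <ᵇ shift (p′ i)) xor (kq <ᵇ shift (q′ i))
          ≡⟨ not-xor-not (kp <ᵇ shift (p′ i)) (kq <ᵇ shift (q′ i)) ⟨
        not (kp <ᵇ shift (p′ i)) xor not (kq <ᵇ shift (q′ i))
          ≡⟨ cong₂ _xor_ (<ᵇ-swap (kp-new i)) (<ᵇ-swap (kq-new i)) ⟨
        (shift (p′ i) <ᵇ kp) xor (shift (q′ i) <ᵇ kq)
          ∎
        where open ≡-Reasoning
      ... | old i | old j
        rewrite extend-ι p′ kp i | extend-ι q′ kq i | extend-ι p′ kp j | extend-ι q′ kq j =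
        trans (adjacency i j (a≢b ∘ cong ι))
              (sym (cong₂ _xor_ (shift-<ᵇ (p′ i) (p′ j)) (shift-<ᵇ (q′ i) (q′ j))))

    module Reinsert {p′ q′ : Fin (suc m) → ℕ} (r : Realizer C′ p′ q′) where
      open Realizer r

      module Placement (s : Bool) (a : Fin (suc m)) where

        kp : ℕ
        kp = beside s (p′ a)

        -- v goes next to x = ι⁻¹ u in q, on the side that makes C v u come out right.
        τ-side : Bool
        τ-side = (kp <ᵇ shift (p′ x)) xor C v u

        kq : ℕ
        kq = beside τ-side (q′ x)

        p q : Fin (suc (suc m)) → ℕ
        p = extend p′ kp
        q = extend q′ kq

        Adjacency-v : Fin (suc m) → Set
        Adjacency-v j = C v (ι j) ≡ (kp <ᵇ shift (p′ j)) xor (kq <ᵇ shift (q′ j))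

        adjacency-x : Adjacency-v x
        adjacency-x = begin
          C v (ι x)                          ≡⟨ cong (C v) ιx≡u ⟩
          C v u                              ≡⟨ xor-cancelˡ t (C v u) ⟨
          t xor τ-side                       ≡⟨ cong (t xor_) (beside-<ᵇ-self τ-side (q′ x)) ⟨
          t xor (kq <ᵇ shift (q′ x))         ∎
          where
          open ≡-Reasoning
          t : Bool
          t = kp <ᵇ shift (p′ x)

        adjacency-nonRed : ∀ {j} → j ≢ x → H′ x j ≢ red → (kp <ᵇ shift (p′ j)) ≡ (p′ x <ᵇ p′ j) → Adjacency-v j
        adjacency-nonRed {j} j≢x xj-nonRed kp-vs-j = begin
          C v (ι j)                                    ≡⟨ C-v≡C′-x j≢x xj-nonRed ⟩
          C′ x j                                       ≡⟨ adjacency x j (j≢x ∘ sym) ⟩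
          (p′ x <ᵇ p′ j) xor (q′ x <ᵇ q′ j)            ≡⟨ cong₂ _xor_ kp-vs-j kq-vs-j ⟨
          (kp <ᵇ shift (p′ j)) xor (kq <ᵇ shift (q′ j)) ∎
          where
          open ≡-Reasoning
          kq-vs-j : (kq <ᵇ shift (q′ j)) ≡ (q′ x <ᵇ q′ j)
          kq-vs-j = beside-<ᵇ-shift τ-side (q-injective x j (j≢x ∘ sym))

        realizer : (∀ {j} → j ≢ x → Adjacency-v j) → Realizer C p q
        realizer adj-old = realizer-extend r (λ _ → beside≢shift s _ _) (λ _ → beside≢shift τ-side _ _) adj
          where
          adj : ∀ j → Adjacency-v j
          adj j with j Fin.≟ x
          ... | yes refl = adjacency-x
          ... | no j≢x   = adj-old j≢x

        v-consecutive-x : Consecutive q v (ι x)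
        v-consecutive-x = consecutive-beside τ-side q-injective

        consecutive-preserved : ∀ {i j} → a ≢ i → a ≢ j → x ≢ i → x ≢ j →
          Consecutive p′ i j ⊎ Consecutive q′ i j → Consecutive p (ι i) (ι j) ⊎ Consecutive q (ι i) (ι j)
        consecutive-preserved a≢i a≢j x≢i x≢j = Sum.map
          (λ c → consecutive-extend-beside s p-injective c a≢i a≢j)
          (λ c → consecutive-extend-beside τ-side q-injective c x≢i x≢j)

      withoutRedNeighbour : RedConsecutive H′ p′ q′ → (∀ {j} → j ≢ x → H′ x j ≢ red) → Realization H C
      withoutRedNeighbour rc x-nonRed =
        p , q , realizer adj-old , redConsecutive-extend {p} {q} at-v at-x elsewhere
        where
        open Placement true x
        adj-old : ∀ {j} → j ≢ x → Adjacency-v j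
        adj-old j≢x = adjacency-nonRed j≢x (x-nonRed j≢x) (beside-<ᵇ-shift true (p-injective x _ (j≢x ∘ sym)))
        at-v : ∀ j → H v (ι j) ≡ red → Consecutive p v (ι j) ⊎ Consecutive q v (ι j)
        at-v j vj-red with j Fin.≟ x
        ... | yes refl = inj₂ v-consecutive-x
        ... | no j≢x   = contradiction (H′-red-from-v j≢x vj-red) (x-nonRed j≢x)
        at-x : ∀ j → j ≢ x → H (ι x) (ι j) ≡ red → Consecutive p (ι x) (ι j) ⊎ Consecutive q (ι x) (ι j)
        at-x j j≢x xj-red = contradiction (H′-red-from-u j≢x xj-red) (x-nonRed j≢x)
        elsewhere : ∀ i j → i ≢ x → j ≢ x → i ≢ j → H′ i j ≡ red →
                    Consecutive p (ι i) (ι j) ⊎ Consecutive q (ι i) (ι j)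
        elsewhere i j i≢x j≢x i≢j ij-red =
          consecutive-preserved (i≢x ∘ sym) (j≢x ∘ sym) (i≢x ∘ sym) (j≢x ∘ sym) (rc i j i≢j ij-red)

      module WithRedNeighbour (H-deg : MaxRedDegAtMost 1 H) (H′-deg : MaxRedDegAtMost 1 H′)
                              (rc : RedConsecutive H′ p′ q′) {y} (y≢x : y ≢ x) (xy-red : H′ x y ≡ red)
                              (xy-consecutive : Consecutive p′ x y) where

        x-redNeighbour : ∀ {j} → j ≢ x → H′ x j ≡ red → j ≡ y
        x-redNeighbour j≢x xj-red = atMostOneRedNeighbour H′-deg (j≢x ∘ sym) (y≢x ∘ sym) xj-red xy-red

        y-redNeighbour : ∀ {j} → j ≢ y → H′ y j ≡ red → j ≡ x
        y-redNeighbour j≢y yj-red =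
          atMostOneRedNeighbour H′-deg (j≢y ∘ sym) y≢x yj-red (trans (contract-symmetric H-sym y x) xy-red)

        -- As v sits next to x in q, it is ordered like x against y there; this is the
        -- side of y on which v must then lie in p.
        σ-side : Bool
        σ-side = C v (ι y) xor (q′ x <ᵇ q′ y)

        anchor-vs-other : ∀ {a} → a ≡ x ⊎ a ≡ y → ∀ {j} → j ≢ x → j ≢ y →
                          (beside σ-side (p′ a) <ᵇ shift (p′ j)) ≡ (p′ x <ᵇ p′ j)
        anchor-vs-other (inj₁ refl) j≢x j≢y = beside-<ᵇ-shift σ-side (p-injective x _ (j≢x ∘ sym))
        anchor-vs-other (inj₂ refl) j≢x j≢y =
          trans (beside-<ᵇ-shift σ-side (p-injective y _ (j≢y ∘ sym))) (sym (xy-consecutive _ j≢x j≢y))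

        anchor≢ : ∀ {a} → a ≡ x ⊎ a ≡ y → ∀ {j} → j ≢ x → j ≢ y → a ≢ j
        anchor≢ (inj₁ refl) j≢x j≢y = j≢x ∘ sym
        anchor≢ (inj₂ refl) j≢x j≢y = j≢y ∘ sym

        module Anchored (a : Fin (suc m)) (a≡x⊎y : a ≡ x ⊎ a ≡ y)
                        (kp-vs-y : (beside σ-side (p′ a) <ᵇ shift (p′ y)) ≡ σ-side) where
          open Placement σ-side a public

          adjacency-y : Adjacency-v y
          adjacency-y = begin
            C v (ι y)                                      ≡⟨ xor-cancelʳ (C v (ι y)) (q′ x <ᵇ q′ y) ⟨
            σ-side xor (q′ x <ᵇ q′ y)                      ≡⟨ cong₂ _xor_ kp-vs-y kq-vs-y ⟨
            (kp <ᵇ shift (p′ y)) xor (kq <ᵇ shift (q′ y))  ∎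
            where
            open ≡-Reasoning
            kq-vs-y : (kq <ᵇ shift (q′ y)) ≡ (q′ x <ᵇ q′ y)
            kq-vs-y = beside-<ᵇ-shift τ-side (q-injective x y (y≢x ∘ sym))

          adj-old : ∀ {j} → j ≢ x → Adjacency-v j
          adj-old {j} j≢x with j Fin.≟ y
          ... | yes refl = adjacency-y
          ... | no j≢y   = adjacency-nonRed j≢x (j≢y ∘ x-redNeighbour j≢x) (anchor-vs-other a≡x⊎y j≢x j≢y)

          realization : (H v (ι y) ≡ red → Consecutive p v (ι y)) →
                        (H (ι x) (ι y) ≡ red → Consecutive p (ι x) (ι y)) → Realization H C
          realization at-vy at-xy = p , q , realizer adj-old , redConsecutive-extend {p} {q} at-v at-x elsewhere
            where
            at-v : ∀ j → H v (ι j) ≡ red → Consecutive p v (ι j) ⊎ Consecutive q v (ι j)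
            at-v j vj-red with j Fin.≟ x
            ... | yes refl = inj₂ v-consecutive-x
            ... | no j≢x with x-redNeighbour j≢x (H′-red-from-v j≢x vj-red)
            ...   | refl = inj₁ (at-vy vj-red)
            at-x : ∀ j → j ≢ x → H (ι x) (ι j) ≡ red → Consecutive p (ι x) (ι j) ⊎ Consecutive q (ι x) (ι j)
            at-x j j≢x xj-red with x-redNeighbour j≢x (H′-red-from-u j≢x xj-red)
            ... | refl = inj₁ (at-xy xj-red)
            elsewhere : ∀ i j → i ≢ x → j ≢ x → i ≢ j → H′ i j ≡ red →
                        Consecutive p (ι i) (ι j) ⊎ Consecutive q (ι i) (ι j)
            elsewhere i j i≢x j≢x i≢j ij-red with i Fin.≟ y | j Fin.≟ y
            ... | yes refl | _        = contradiction (y-redNeighbour (i≢j ∘ sym) ij-red) j≢x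
            ... | no i≢y   | yes refl =
              contradiction (y-redNeighbour i≢j (trans (contract-symmetric H-sym y i) ij-red)) i≢x
            ... | no i≢y   | no j≢y   = consecutive-preserved (anchor≢ a≡x⊎y i≢x i≢y) (anchor≢ a≡x⊎y j≢x j≢y)
                                          (i≢x ∘ sym) (j≢x ∘ sym) (rc i j i≢j ij-red)

        nextToY : H u (ι y) ≢ red → Realization H C
        nextToY uy-nonRed = realization (λ _ → consecutive-beside σ-side p-injective)
          (λ xy-red′ → contradiction (trans (cong (λ w → H w (ι y)) (sym ιx≡u)) xy-red′) uy-nonRed)
          where open Anchored y (inj₂ refl) (beside-<ᵇ-self σ-side (p′ y))

        -- Here uy is red in H, so v must not separate x = u and y in p.
        besideEdge : ∀ a → a ≡ x ⊎ a ≡ y → (beside σ-side (p′ a) <ᵇ shift (p′ y)) ≡ σ-side →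
                     (beside σ-side (p′ a) <ᵇ shift (p′ x)) ≡ σ-side → H u (ι y) ≡ red → Realization H C
        besideEdge a a≡x⊎y kp-vs-y kp-vs-x uy-red = realization
          (λ vy-red → contradiction (atMostOneRedNeighbour H-deg (ι≢u y≢x) (ι≢v y)
             (trans (H-sym (ι y) u) uy-red) (trans (H-sym (ι y) v) vy-red)) u≢v)
          (λ _ → consecutive-extend xy-consecutive kp-outside)
          where
          open Anchored a a≡x⊎y kp-vs-y
          open ≡-Reasoning
          kp-outside : (shift (p′ x) <ᵇ kp) ≡ (shift (p′ y) <ᵇ kp)
          kp-outside = begin
            shift (p′ x) <ᵇ kp        ≡⟨ <ᵇ-swap (beside≢shift σ-side _ _) ⟩
            not (kp <ᵇ shift (p′ x))  ≡⟨ cong not (trans kp-vs-x (sym kp-vs-y)) ⟩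
            not (kp <ᵇ shift (p′ y))  ≡⟨ <ᵇ-swap (beside≢shift σ-side _ _) ⟨
            shift (p′ y) <ᵇ kp        ∎

        realization : Realization H C
        realization with red? (H u (ι y))
        ... | no uy-nonRed = nextToY uy-nonRed
        ... | yes uy-red with (p′ x <ᵇ p′ y) Bool.≟ σ-side
        ...   | yes x<y≡σ = besideEdge x (inj₁ refl)
                  (trans (beside-<ᵇ-shift σ-side (p-injective x y (y≢x ∘ sym))) x<y≡σ)
                  (beside-<ᵇ-self σ-side (p′ x)) uy-red
        ...   | no x<y≢σ  = besideEdge y (inj₂ refl) (beside-<ᵇ-self σ-side (p′ y))
                  (trans (beside-<ᵇ-shift σ-side (p-injective y x y≢x))
                         (trans (<ᵇ-swap (p-injective x y (y≢x ∘ sym))) (sym (¬-not (x<y≢σ ∘ sym)))))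
                  uy-red

    realization : MaxRedDegAtMost 1 H → MaxRedDegAtMost 1 H′ → Realization H′ C′ → Realization H C
    realization H-deg H′-deg (p′ , q′ , r , rc) with Fin.any? (λ j → ¬? (j Fin.≟ x) ×-dec red? (H′ x j))
    ... | no no-red = Reinsert.withoutRedNeighbour r rc (λ j≢x xj-red → no-red (_ , j≢x , xj-red))
    ... | yes (y , y≢x , xy-red) with rc x y (y≢x ∘ sym) xy-red
    ...   | inj₁ in-p = Reinsert.WithRedNeighbour.realization r H-deg H′-deg rc y≢x xy-red in-p
    ...   | inj₂ in-q with Reinsert.WithRedNeighbour.realization (realizer-swap r) H-deg H′-deg
                             (redConsecutive-swap {p = p′} {q′} rc) y≢x xy-red in-q
    ...     | p , q , r′ , rc′ = q , p , realizer-swap r′ , redConsecutive-swap {p = p} {q} rc′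

  realizable-uncontract : MaxRedDegAtMost 1 H → MaxRedDegAtMost 1 H′ → Realizable H′ → Realizable H
  realizable-uncontract H-deg H′-deg H′-realizable C C-compl =
    realization H-deg H′-deg (H′-realizable C′ C′-completion)
    where open Completed C C-compl

dseq-maxRedDeg : ∀ {d m} {H : Trigraph (suc m)} → DSeq d H → MaxRedDegAtMost d H
dseq-maxRedDeg (done _ deg)         = deg
dseq-maxRedDeg (step _ deg _ _ _ _) = deg

realizable-singleton : (H : Trigraph 1) → Realizable H
realizable-singleton H C _ = (λ _ → 0) , (λ _ → 0) , realizer , λ a b a≢b _ → contradiction (unique a b) a≢b
  where
  unique : (a b : Fin 1) → a ≡ b
  unique Fin.zero Fin.zero = refl
  realizer : Realizer C (λ _ → 0) (λ _ → 0)
  realizer = record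
    { p-injective = λ a b a≢b → contradiction (unique a b) a≢b
    ; q-injective = λ a b a≢b → contradiction (unique a b) a≢b
    ; adjacency   = λ a b a≢b → contradiction (unique a b) a≢b
    }

realizable : ∀ {m} {H : Trigraph (suc m)} → IsSymmetric H → DSeq 1 H → Realizable H
realizable _     (done H _)                 = realizable-singleton H
realizable H-sym (step H deg u v u≢v steps) =
  Uncontraction.realizable-uncontract H H-sym u v u≢v deg (dseq-maxRedDeg steps)
    (realizable (Contraction.contract-symmetric H u v H-sym) steps)

injective⇒surjective : ∀ {n} (f : Fin n → Fin n) → (∀ {a b} → f a ≡ f b → a ≡ b) → ∀ y → ∃ λ a → f a ≡ y
injective⇒surjective {suc n} f f-inj y with Fin.any? (λ a → f a Fin.≟ y)
... | yes hit = hit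
... | no miss = contradiction (Fin.injective⇒≤ g-inj) ℕ.1+n≰n
  where
  g : Fin (suc n) → Fin n
  g a = punchOut {i = y} {j = f a} (λ y≡fa → miss (a , sym y≡fa))
  g-inj : ∀ {a b} → g a ≡ g b → a ≡ b
  g-inj {a} {b} = f-inj ∘ Fin.punchOut-injective (λ y≡fa → miss (a , sym y≡fa)) (λ y≡fb → miss (b , sym y≡fb))

indicator : Bool → ℕ
indicator b = if b then 1 else 0

indicator≤1 : ∀ b → indicator b ≤ 1
indicator≤1 true  = ℕ.≤-refl
indicator≤1 false = z≤n

module Ranking {n} (f : Fin n → ℕ) (f-injective : Injective f) where

  rankℕ : Fin n → ℕ
  rankℕ a = sum (tabulate λ w → indicator (f w <ᵇ f a))

  indicator-self : ∀ a → indicator (f a <ᵇ f a) ≡ 0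
  indicator-self a = cong indicator (<ᵇ-irrefl (f a))

  rankℕ<n : ∀ a → rankℕ a < n
  rankℕ<n a = subst (rankℕ a <_) (sum-tabulate-1 n)
    (sum-tabulate-mono-< (λ w → indicator≤1 (f w <ᵇ f a)) a (subst (_< 1) (sym (indicator-self a)) ℕ.≤-refl))

  rankℕ-monotone : ∀ {a b} → (f a <ᵇ f b) ≡ true → rankℕ a < rankℕ b
  rankℕ-monotone {a} {b} a<b = sum-tabulate-mono-< pointwise a
    (subst₂ _<_ (sym (indicator-self a)) (cong indicator (sym a<b)) ℕ.≤-refl)
    where
    pointwise : ∀ w → indicator (f w <ᵇ f a) ≤ indicator (f w <ᵇ f b)
    pointwise w with f w <ᵇ f a in w<a
    ... | false = z≤n
    ... | true rewrite <ᵇ-trans (f w) (f a) (f b) w<a a<b = ℕ.≤-refl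

  rank : Fin n → Fin n
  rank a = fromℕ< (rankℕ<n a)

  rank-< : ∀ {a b} → (f a <ᵇ f b) ≡ true → rank a Fin.< rank b
  rank-< {a} {b} a<b =
    subst₂ _<_ (sym (Fin.toℕ-fromℕ< (rankℕ<n a))) (sym (Fin.toℕ-fromℕ< (rankℕ<n b))) (rankℕ-monotone a<b)

  rank-> : ∀ {a b} → a ≢ b → (f a <ᵇ f b) ≡ false → rank b Fin.< rank a
  rank-> a≢b a≮b = rank-< (trans (<ᵇ-swap (f-injective _ _ a≢b)) (cong not a≮b))

  rank-<⁻¹ : ∀ {a b} → rank a Fin.< rank b → (f a <ᵇ f b) ≡ true
  rank-<⁻¹ {a} {b} ra<rb with f a <ᵇ f b in a<b
  ... | true  = refl
  ... | false = contradiction (rank-> (λ { refl → Fin.<-irrefl refl ra<rb }) a<b) (Fin.<-asym ra<rb)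

  rank->⁻¹ : ∀ {a b} → a ≢ b → rank b Fin.< rank a → (f a <ᵇ f b) ≡ false
  rank->⁻¹ a≢b rb<ra = trans (<ᵇ-swap (f-injective _ _ (a≢b ∘ sym))) (cong not (rank-<⁻¹ rb<ra))

  rank-injective : ∀ {a b} → rank a ≡ rank b → a ≡ b
  rank-injective {a} {b} ra≡rb with a Fin.≟ b
  ... | yes a≡b = a≡b
  ... | no a≢b with f a <ᵇ f b in a<b
  ...   | true  = contradiction ra≡rb (Fin.<⇒≢ (rank-< a<b))
  ...   | false = contradiction (sym ra≡rb) (Fin.<⇒≢ (rank-> a≢b a<b))

  rank-bijection : Fin n ⤖ Fin n
  rank-bijection = mk⤖ (rank-injective , λ r → let (a , ra≡r) = injective⇒surjective rank rank-injective r
                                              in a , λ b≡a → trans (cong rank b≡a) ra≡r)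

isPermutationGraph-realizer : ∀ {n} (G : Graph n) {p q} → Realizer (Graph.adj G) p q → IsPermutationGraph G
isPermutationGraph-realizer {n} G {p} {q} r =
  P.rank-bijection , Q.rank-bijection , λ a b a≢b → mk⇔ (adjacent⇒ordered a b a≢b) (ordered⇒adjacent a b a≢b)
  where
  open Realizer r
  module P = Ranking p p-injective
  module Q = Ranking q q-injective
  Ordered : Fin n → Fin n → Set
  Ordered = OrderedDifferently P.rank-bijection Q.rank-bijection
  adjacent⇒ordered : ∀ a b → a ≢ b → Graph.adj G a b ≡ true → Ordered a b
  adjacent⇒ordered a b a≢b ab with p a <ᵇ p b in a<b | q a <ᵇ q b in a<′b | adjacency a b a≢b
  ... | true  | false | _  = inj₁ (P.rank-< a<b , Q.rank-> a≢b a<′b)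
  ... | false | true  | _  = inj₂ (P.rank-> a≢b a<b , Q.rank-< a<′b)
  ... | true  | true  | ab′ = contradiction (trans (sym ab) ab′) λ ()
  ... | false | false | ab′ = contradiction (trans (sym ab) ab′) λ ()
  ordered⇒adjacent : ∀ a b → a ≢ b → Ordered a b → Graph.adj G a b ≡ true
  ordered⇒adjacent a b a≢b (inj₁ (a<b , b<′a))
    rewrite adjacency a b a≢b | P.rank-<⁻¹ a<b | Q.rank->⁻¹ a≢b b<′a = refl
  ordered⇒adjacent a b a≢b (inj₂ (b<a , a<′b))
    rewrite adjacency a b a≢b | P.rank->⁻¹ a≢b b<a | Q.rank-<⁻¹ a<′b = refl

toTrigraph-completion : ∀ {n} (G : Graph n) → IsCompletion (toTrigraph G) (Graph.adj G)
toTrigraph-completion G = record { compatible = λ a b _ → compatible a b ; symmetric = Graph.sym G }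
  where
  compatible : ∀ a b → Compatible (toTrigraph G a b) (Graph.adj G a b)
  compatible a b with Graph.adj G a b
  ... | true  = refl
  ... | false = refl

toTrigraph-symmetric : ∀ {n} (G : Graph n) → IsSymmetric (toTrigraph G)
toTrigraph-symmetric G a b with Graph.adj G a b | Graph.adj G b a | Graph.sym G a b
... | true  | true  | _ = refl
... | false | false | _ = refl

mainTheorem1 : (n : ℕ) (G : Graph n) → TwinWidthAtMost 1 G → IsPermutationGraph G
mainTheorem1 zero    G _     = ⤖-id (Fin 0) , ⤖-id (Fin 0) , λ ()
mainTheorem1 (suc m) G steps
  with realizable (toTrigraph-symmetric G) steps (Graph.adj G) (toTrigraph-completion G)
... | _ , _ , realizer , _ = isPermutationGraph-realizer G realizer
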